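{- With the notation below, $T_0(T_0(\triangle_{00}))=\{\lambda\in\mathcal P_{\ge3}: k_{m-1}<k_m<k_1\}\cup\{\lambda\in\mathcal P_2: k_2<k_1<2k_2\}$; $T_1(T_0(\triangle_{01}))=\{\lambda\in\mathcal P_{\ge2}: k_1<k_m<2k_1\}$; $T_0(T_1(\triangle_{10}))=\{\lambda\in\mathcal P_{\ge3}: k_m<k_{m-1},\ k_m<k_1\}\cup\{\lambda\in\mathcal P_2: k_1>2k_2\}$; $T_1(T_1(\triangle_{11}))=\{\lambda\in\mathcal P_{\ge2}: 2k_1<k_m\}$.
   Context: A partition is written $\lambda=(\lambda_1,\dots,\lambda_m)\times[k_1,\dots,k_m]$, where $m\ge1$, the parts $\lambda_i$ are integers with $\lambda_1>\dots>\lambda_m>0$ and the multiplicities $k_i$ are positive integers; $m$ is its dimension. $\mathcal P_2$ is the set of partitions of dimension $2$ and $\mathcal P_{\ge r}$ the set of those of dimension $\ge r$. Among partitions of dimension $m\ge2$, $\triangle_0$ is the set with $\lambda_1<\lambda_2+\lambda_m$ and $\triangle_1$ the set with $\lambda_1>\lambda_2+\lambda_m$ (for $m=2$, $\lambda_2+\lambda_m$ means $2\lambda_2$). $T_0(\lambda)=(\lambda_2,\dots,\lambda_m,\lambda_1-\lambda_2)\times[k_1+k_2,k_3,\dots,k_m,k_1]$ for $\lambda\in\triangle_0$ (for $m=2$: $(\lambda_2,\lambda_1-\lambda_2)\times[k_1+k_2,k_1]$), and $T_1(\lambda)=(\lambda_1-\lambda_m,\lambda_2,\dots,\lambda_m)\times[k_1,\dots,k_{m-1},k_1+k_m]$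 for $\lambda\in\triangle_1$. The cylinder sets are $\triangle_{ij}=\{\lambda\in\triangle_i:T_i(\lambda)\in\triangle_j\}$ for $i,j\in\{0,1\}$. -}

module Defs where

open import Data.Nat using (ℕ; zero; suc; _+_; _*_; _∸_; _<_; _>_; _≤_)
open import Data.Product using (_×_; _,_; proj₁; proj₂)
open import Data.List using (List; []; _∷_; _++_; map; length)
open import Data.List.Relation.Unary.All using (All)
open import Data.List.Relation.Unary.Linked using (Linked)
open import Relation.Binary.PropositionalEquality using (_≡_)

-- A (raw) partition λ = (λ₁,…,λₘ) × [k₁,…,kₘ] is stored as the list of
-- pairs ((λ₁ , k₁) ∷ … ∷ (λₘ , kₘ) ∷ []).
Rep : Set
Rep = List (ℕ × ℕ)

parts : Rep → List ℕ
parts = map proj₁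

mults : Rep → List ℕ
mults = map proj₂

dim : Rep → ℕ
dim = length

IsPartition : Rep → Set
IsPartition μ = (1 ≤ dim μ) × Linked _>_ (parts μ) × All (0 <_) (parts μ) × All (0 <_) (mults μ)

-- first, second, last and second-to-last entries (junk (0,0) if absent)
firstE : Rep → ℕ × ℕ
firstE [] = (0 , 0)
firstE (p ∷ _) = p

secondE : Rep → ℕ × ℕ
secondE (_ ∷ q ∷ _) = q
secondE _ = (0 , 0)

lastFrom : ℕ × ℕ → Rep → ℕ × ℕ
lastFrom p [] = p
lastFrom _ (q ∷ qs) = lastFrom q qs

lastE : Rep → ℕ × ℕ
lastE [] = (0 , 0)
lastE (p ∷ ps) = lastFrom p ps

secondLastE : Rep → ℕ × ℕ
secondLastE (p ∷ q ∷ []) = p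
secondLastE (p ∷ q ∷ r ∷ rs) = secondLastE (q ∷ r ∷ rs)
secondLastE _ = (0 , 0)

λ₁ λ₂ λₘ k₁ k₂ kₘ kₘ₋₁ : Rep → ℕ
λ₁ μ = proj₁ (firstE μ)
λ₂ μ = proj₁ (secondE μ)
λₘ μ = proj₁ (lastE μ)
k₁ μ = proj₂ (firstE μ)
k₂ μ = proj₂ (secondE μ)
kₘ μ = proj₂ (lastE μ)
kₘ₋₁ μ = proj₂ (secondLastE μ)

P₂ : Rep → Set
P₂ μ = IsPartition μ × dim μ ≡ 2

P≥ : ℕ → Rep → Set
P≥ r μ = IsPartition μ × r ≤ dim μ

△₀ : Rep → Set
△₀ μ = P≥ 2 μ × λ₁ μ < λ₂ μ + λₘ μ

△₁ : Rep → Set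
△₁ μ = P≥ 2 μ × λ₁ μ > λ₂ μ + λₘ μ

T₀ : Rep → Rep
T₀ ((l1 , c1) ∷ (l2 , c2) ∷ rest) = (l2 , c1 + c2) ∷ (rest ++ ((l1 ∸ l2 , c1) ∷ []))
T₀ μ = μ

bumpLast : ℕ → Rep → Rep
bumpLast c [] = []
bumpLast c ((l , k) ∷ []) = (l , c + k) ∷ []
bumpLast c (p ∷ q ∷ qs) = p ∷ bumpLast c (q ∷ qs)

-- T₁(λ) = (λ₁-λₘ,λ₂,…,λₘ) × [k₁,…,kₘ₋₁,k₁+kₘ]
T₁ : Rep → Rep
T₁ ((l1 , c1) ∷ p ∷ ps) = (l1 ∸ proj₁ (lastFrom p ps) , c1) ∷ bumpLast c1 (p ∷ ps)
T₁ μ = μ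

△₀₀ △₀₁ △₁₀ △₁₁ : Rep → Set
△₀₀ μ = △₀ μ × △₀ (T₀ μ)
△₀₁ μ = △₀ μ × △₁ (T₀ μ)
△₁₀ μ = △₁ μ × △₀ (T₁ μ)
△₁₁ μ = △₁ μ × △₁ (T₁ μ)

module Submission where

open import Defs
open import Data.Nat using (ℕ; suc; _+_; _*_; _∸_; _<_; _>_; _≤_; z≤n; s≤s)
open import Data.Nat.Properties
  using ( +-comm; +-identityʳ; +-monoʳ-<; +-monoˡ-<; +-cancelˡ-<; <⇒≤; <-≤-trans; ≤-<-trans; ≤-trans
        ; m≤m+n; m≤n+m; m<m+n; m<n+m; m<n⇒0<n∸m; m+n≤o⇒m≤o∸n; m+n∸n≡m; m+n∸m≡n; m+[n∸m]≡n; m∸n+n≡m )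
open import Data.Product using (_×_; ∃-syntax; _,_; proj₁; proj₂)
open import Data.Sum using (_⊎_; inj₁; inj₂)
open import Data.List using ([]; _∷_; _∷ʳ_; initLast; _∷ʳ′_)
open import Data.List.Relation.Unary.All as All using (All; []; _∷_)
import Data.List.Relation.Unary.All.Properties as All
open import Data.List.Relation.Unary.Linked using (Linked; []; [-]; _∷_)
import Data.List.Relation.Unary.Linked.Properties as Linked
open import Function.Base using (_on_)
open import Function.Bundles using (_⇔_; mk⇔; Equivalence)
open import Function.Construct.Composition using (_⇔-∘_)
open import Relation.Binary.Core using (Rel)
open import Relation.Binary.PropositionalEquality
  using (_≡_; refl; sym; trans; cong; cong₂; subst; subst₂)

-- T₀ is a bijection from △₀ onto the partitions of dimension ≥ 2 with kₘ < k₁, and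
-- T₁ one from △₁ onto those with k₁ < kₘ; both inverses are explicit. Hence
-- Tⱼ(Tᵢ(△ᵢⱼ)) = Tⱼ(△ⱼ ∩ Tᵢ(△ᵢ)) is the set of μ ∈ Tⱼ(△ⱼ) with Tⱼ⁻¹ μ ∈ Tᵢ(△ᵢ), and each
-- condition is read off from the first and last multiplicities of Tⱼ⁻¹ μ.

record InverseOn {X Y : Set} (A : X → Set) (B : Y → Set) (f : X → Y) (g : Y → X) : Set where
  field
    maps     : ∀ {x} → A x → B (f x)
    maps⁻¹   : ∀ {y} → B y → A (g y)
    inverseˡ : ∀ {y} → B y → f (g y) ≡ y
    inverseʳ : ∀ {x} → A x → g (f x) ≡ x

image-∘ : ∀ {X Y Z : Set} {A₁ : X → Set} {B₁ A₂ : Y → Set} {B₂ : Z → Set}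
            {f₁ : X → Y} {g₁ : Y → X} {f₂ : Y → Z} {g₂ : Z → Y} →
          InverseOn A₁ B₁ f₁ g₁ → InverseOn A₂ B₂ f₂ g₂ →
          ∀ z → (∃[ x ] ((A₁ x × A₂ (f₁ x)) × f₂ (f₁ x) ≡ z)) ⇔ (B₂ z × B₁ (g₂ z))
image-∘ {A₁ = A₁} {B₁} {A₂} {B₂} {f₁} {g₁} {f₂} {g₂} i₁ i₂ z = mk⇔ ⇒ ⇐
  where
  module I₁ = InverseOn i₁
  module I₂ = InverseOn i₂

  ⇒ : ∃[ x ] ((A₁ x × A₂ (f₁ x)) × f₂ (f₁ x) ≡ z) → B₂ z × B₁ (g₂ z)
  ⇒ (x , (a₁ , a₂) , refl) = I₂.maps a₂ , subst B₁ (sym (I₂.inverseʳ a₂)) (I₁.maps a₁)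

  ⇐ : B₂ z × B₁ (g₂ z) → ∃[ x ] ((A₁ x × A₂ (f₁ x)) × f₂ (f₁ x) ≡ z)
  ⇐ (b₂ , b₁) =
    g₁ (g₂ z) , (I₁.maps⁻¹ b₁ , subst A₂ (sym (I₁.inverseˡ b₁)) (I₂.maps⁻¹ b₂))
              , trans (cong f₂ (I₁.inverseˡ b₁)) (I₂.inverseˡ b₂)

2*m≡m+m : ∀ m → 2 * m ≡ m + m
2*m≡m+m m = cong (m +_) (+-identityʳ m)

n∸m<m⇔n<2*m : ∀ {m n} → m ≤ n → (n ∸ m < m) ⇔ (n < 2 * m)
n∸m<m⇔n<2*m {m} {n} m≤n = mk⇔
  (λ lt → subst₂ _<_ (m+[n∸m]≡n m≤n) (sym (2*m≡m+m m)) (+-monoʳ-< m lt))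
  (λ lt → +-cancelˡ-< m _ _ (subst₂ _<_ (sym (m+[n∸m]≡n m≤n)) (2*m≡m+m m) lt))

m<n∸m⇔2*m<n : ∀ {m n} → m ≤ n → (m < n ∸ m) ⇔ (2 * m < n)
m<n∸m⇔2*m<n {m} {n} m≤n = mk⇔
  (λ lt → subst₂ _<_ (sym (2*m≡m+m m)) (m+[n∸m]≡n m≤n) (+-monoʳ-< m lt))
  (λ lt → +-cancelˡ-< m _ _ (subst₂ _<_ (2*m≡m+m m) (sym (m+[n∸m]≡n m≤n)) lt))

2*m<n⇒m<n : ∀ {m n} → 2 * m < n → m < n
2*m<n⇒m<n {m} lt = ≤-<-trans (m≤m+n m (m + 0)) lt

m<n+o⇒m∸n<o′ : ∀ {m n o} → n ≤ m → m < n + o → m ∸ n < o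
m<n+o⇒m∸n<o′ {m} {n} n≤m lt = +-cancelˡ-< n _ _ (subst (_< n + _) (sym (m+[n∸m]≡n n≤m)) lt)

initFrom : ℕ × ℕ → Rep → Rep
initFrom p []       = []
initFrom p (q ∷ qs) = p ∷ initFrom q qs

lastFrom-∷ʳ : ∀ p xs q → lastFrom p (xs ∷ʳ q) ≡ q
lastFrom-∷ʳ p []       q = refl
lastFrom-∷ʳ p (x ∷ xs) q = lastFrom-∷ʳ x xs q

initFrom-∷ʳ : ∀ p xs q → initFrom p (xs ∷ʳ q) ≡ p ∷ xs
initFrom-∷ʳ p []       q = refl
initFrom-∷ʳ p (x ∷ xs) q = cong (p ∷_) (initFrom-∷ʳ x xs q)

lastFrom-initFrom : ∀ p q qs → lastFrom p (initFrom q qs) ≡ secondLastE (p ∷ q ∷ qs)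
lastFrom-initFrom p q []       = refl
lastFrom-initFrom p q (r ∷ rs) = lastFrom-initFrom q r rs

bumpLast-∷ʳ : ∀ c xs l k → bumpLast c (xs ∷ʳ (l , k)) ≡ xs ∷ʳ (l , c + k)
bumpLast-∷ʳ c []           l k = refl
bumpLast-∷ʳ c (x ∷ [])     l k = refl
bumpLast-∷ʳ c (x ∷ y ∷ ys) l k = cong (x ∷_) (bumpLast-∷ʳ c (y ∷ ys) l k)

λₘ-∷ʳ : ∀ x xs y → λₘ (x ∷ xs ∷ʳ y) ≡ proj₁ y
λₘ-∷ʳ x xs y = cong proj₁ (lastFrom-∷ʳ x xs y)

kₘ-∷ʳ : ∀ x xs y → kₘ (x ∷ xs ∷ʳ y) ≡ proj₂ y
kₘ-∷ʳ x xs y = cong proj₂ (lastFrom-∷ʳ x xs y)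

λ₂-∷ʳ : ∀ x x′ xs l k k′ → λ₂ (x′ ∷ xs ∷ʳ (l , k′)) ≡ λ₂ (x ∷ xs ∷ʳ (l , k))
λ₂-∷ʳ x x′ []       l k k′ = refl
λ₂-∷ʳ x x′ (_ ∷ xs) l k k′ = refl

2≤dim-∷ʳ : ∀ x xs y → 2 ≤ dim (x ∷ xs ∷ʳ y)
2≤dim-∷ʳ x []       y = s≤s (s≤s z≤n)
2≤dim-∷ʳ x (_ ∷ xs) y = s≤s (s≤s z≤n)

module _ {ℓ} {R : Rel (ℕ × ℕ) ℓ} where

  Linked-∷ʳ⁺ : ∀ {x xs y} → Linked R (x ∷ xs) → R (lastFrom x xs) y → Linked R (x ∷ xs ∷ʳ y)
  Linked-∷ʳ⁺ {xs = []}     [-]       r = r ∷ [-]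
  Linked-∷ʳ⁺ {xs = _ ∷ _} (r′ ∷ rs) r = r′ ∷ Linked-∷ʳ⁺ rs r

  Linked-∷ʳ⁻ : ∀ {x xs y} → Linked R (x ∷ xs ∷ʳ y) → Linked R (x ∷ xs) × R (lastFrom x xs) y
  Linked-∷ʳ⁻ {xs = []}     (r ∷ [-]) = [-] , r
  Linked-∷ʳ⁻ {xs = _ ∷ _} (r ∷ rs) with Linked-∷ʳ⁻ rs
  ... | rs′ , r′ = r ∷ rs′ , r′

  Linked-replaceHead : ∀ {x x′ xs} → (∀ {y} → R x y → R x′ y) → Linked R (x ∷ xs) → Linked R (x′ ∷ xs)
  Linked-replaceHead f [-]      = [-]
  Linked-replaceHead f (r ∷ rs) = f r ∷ rs

Decreasing : Rep → Set
Decreasing = Linked (_>_ on proj₁)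

Positive : ℕ × ℕ → Set
Positive e = 0 < proj₁ e × 0 < proj₂ e

isPartition : ∀ {x xs} → Decreasing (x ∷ xs) → All Positive (x ∷ xs) → IsPartition (x ∷ xs)
isPartition d pos =
  s≤s z≤n , Linked.map⁺ d , All.map⁺ (All.map proj₁ pos) , All.map⁺ (All.map proj₂ pos)

decreasing : ∀ {μ} → IsPartition μ → Decreasing μ
decreasing (_ , d , _) = Linked.map⁻ d

positive : ∀ {μ} → IsPartition μ → All Positive μ
positive (_ , _ , ps , ks) = All.zip (All.map⁻ ps , All.map⁻ ks)

lastPositive : ∀ {x xs y} → IsPartition (x ∷ xs ∷ʳ y) → Positive y
lastPositive ip = proj₂ (All.∷ʳ⁻ (All.tail (positive ip)))

λ₂<λ₁ : ∀ μ → IsPartition μ → 2 ≤ dim μ → λ₂ μ < λ₁ μ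
λ₂<λ₁ [] _ ()
λ₂<λ₁ (x ∷ []) _ (s≤s ())
λ₂<λ₁ (x ∷ y ∷ ys) ip _ with decreasing ip
... | lt ∷ _ = lt

-- T₀⁻¹ (λ₁,…,λₘ) × [k₁,…,kₘ] = (λₘ+λ₁, λ₁, λ₂,…,λₘ₋₁) × [kₘ, k₁-kₘ, k₂,…,kₘ₋₁], an inverse
-- of T₀ only where kₘ < k₁ (elsewhere k₁-kₘ truncates to 0).
T₀⁻¹ : Rep → Rep
T₀⁻¹ ((a , c) ∷ p ∷ ps) = (proj₁ z + a , proj₂ z) ∷ (a , c ∸ proj₂ z) ∷ initFrom p ps
  where z = lastFrom p ps
T₀⁻¹ μ = μ

-- T₁⁻¹ (λ₁,…,λₘ) × [k₁,…,kₘ] = (λ₁+λₘ, λ₂,…,λₘ) × [k₁,…,kₘ₋₁, kₘ-k₁], meaningful where k₁ < kₘ.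
T₁⁻¹ : Rep → Rep
T₁⁻¹ ((a , c) ∷ p ∷ ps) = (a + proj₁ z , c) ∷ initFrom p ps ∷ʳ (proj₁ z , proj₂ z ∸ c)
  where z = lastFrom p ps
T₁⁻¹ μ = μ

T₀⁻¹-∷ʳ : ∀ a c xs l k → T₀⁻¹ ((a , c) ∷ xs ∷ʳ (l , k)) ≡ (l + a , k) ∷ (a , c ∸ k) ∷ xs
T₀⁻¹-∷ʳ a c []       l k = refl
T₀⁻¹-∷ʳ a c (x ∷ xs) l k rewrite lastFrom-∷ʳ x xs (l , k) | initFrom-∷ʳ x xs (l , k) = refl

T₁-∷ʳ : ∀ a c xs l k → T₁ ((a , c) ∷ xs ∷ʳ (l , k)) ≡ (a ∸ l , c) ∷ xs ∷ʳ (l , c + k)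
T₁-∷ʳ a c []       l k = refl
T₁-∷ʳ a c (x ∷ xs) l k rewrite lastFrom-∷ʳ x xs (l , k) = cong ((a ∸ l , c) ∷_) (bumpLast-∷ʳ c (x ∷ xs) l k)

T₁⁻¹-∷ʳ : ∀ a c xs l k → T₁⁻¹ ((a , c) ∷ xs ∷ʳ (l , k)) ≡ (a + l , c) ∷ xs ∷ʳ (l , k ∸ c)
T₁⁻¹-∷ʳ a c []       l k = refl
T₁⁻¹-∷ʳ a c (x ∷ xs) l k rewrite lastFrom-∷ʳ x xs (l , k) | initFrom-∷ʳ x xs (l , k) = refl

isPartition-rotate : ∀ {a b c d e r} → △₀ ((a , c) ∷ (b , d) ∷ r) → 0 < e → IsPartition ((b , e) ∷ r ∷ʳ (a ∸ b , c))
isPartition-rotate {a} {b} (((ip , _) , lt)) 0<e with decreasing ip | positive ip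
... | b<a ∷ dec | (_ , 0<c) ∷ (0<b , _) ∷ pos =
  isPartition (Linked-replaceHead (λ r → r) (Linked-∷ʳ⁺ dec (m<n+o⇒m∸n<o′ (<⇒≤ b<a) lt)))
              ((0<b , 0<e) ∷ All.∷ʳ⁺ pos (m<n⇒0<n∸m b<a , 0<c))

△₀-unrotate : ∀ {b e xs l k d} → IsPartition ((b , e) ∷ xs ∷ʳ (l , k)) → 0 < d → △₀ ((l + b , k) ∷ (b , d) ∷ xs)
△₀-unrotate {b} {xs = xs} {l} {d = d} ip 0<d
  with Linked-∷ʳ⁻ (Linked-replaceHead (λ r → r) (decreasing ip)) | positive ip
... | dec , l<λ | (0<b , _) ∷ pos with All.∷ʳ⁻ pos
...   | posxs , (0<l , 0<k) =
  (isPartition (m<n+m b 0<l ∷ dec) ((<-≤-trans 0<l (m≤m+n l b) , 0<k) ∷ (0<b , 0<d) ∷ posxs) , s≤s (s≤s z≤n))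
  , subst (_< b + λₘ ((b , d) ∷ xs)) (+-comm b l) (+-monoʳ-< b l<λ)

isPartition-retag : ∀ {a c xs l k a′ k′} → IsPartition ((a , c) ∷ xs ∷ʳ (l , k)) →
        λ₂ ((a , c) ∷ xs ∷ʳ (l , k)) < a′ → 0 < k′ → IsPartition ((a′ , c) ∷ xs ∷ʳ (l , k′))
isPartition-retag {xs = []} ip lt 0<k′ with positive ip
... | (_ , 0<c) ∷ (0<l , _) ∷ [] = isPartition (lt ∷ [-]) ((≤-<-trans z≤n lt , 0<c) ∷ (0<l , 0<k′) ∷ [])
isPartition-retag {xs = z ∷ zs} {l} {k} {k′ = k′} ip lt 0<k′ with decreasing ip | positive ip
... | _ ∷ dec | (_ , 0<c) ∷ pos with Linked-∷ʳ⁻ {x = z} {zs} dec | All.∷ʳ⁻ {xs = z ∷ zs} {x = (l , k)} pos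
...   | dec′ , l<λ | posxs , (0<l , _) =
  isPartition (lt ∷ Linked-∷ʳ⁺ {xs = zs} dec′ l<λ)
              ((≤-<-trans z≤n lt , 0<c) ∷ All.∷ʳ⁺ {x = (l , k′)} posxs (0<l , 0<k′))

T₀[△₀] T₁[△₁] : Rep → Set
T₀[△₀] μ = P≥ 2 μ × kₘ μ < k₁ μ
T₁[△₁] μ = P≥ 2 μ × k₁ μ < kₘ μ

T₀-inverseOn : InverseOn △₀ T₀[△₀] T₀ T₀⁻¹
T₀-inverseOn = record { maps = maps ; maps⁻¹ = maps⁻¹ ; inverseˡ = inverseˡ ; inverseʳ = inverseʳ }
  where
  maps : ∀ {ν} → △₀ ν → T₀[△₀] (T₀ ν)
  maps {[]}                      (((_ , ()) , _))
  maps {_ ∷ []}                  (((_ , s≤s ()) , _))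
  maps {(a , c) ∷ (b , d) ∷ r} h@((ip , _) , _) with positive ip
  ... | _ ∷ (_ , 0<d) ∷ _ =
    (isPartition-rotate h (<-≤-trans 0<d (m≤n+m d c)) , 2≤dim-∷ʳ (b , c + d) r (a ∸ b , c))
    , subst (_< c + d) (sym (kₘ-∷ʳ _ r _)) (m<m+n c 0<d)

  maps⁻¹ : ∀ {μ} → T₀[△₀] μ → △₀ (T₀⁻¹ μ)
  maps⁻¹ {(b , e) ∷ xs} ((ip , 2≤m) , lt) with initLast xs
  maps⁻¹ {(b , e) ∷ _} ((ip , s≤s ()) , lt) | []
  ... | ys ∷ʳ′ (l , k) rewrite T₀⁻¹-∷ʳ b e ys l k =
    △₀-unrotate ip (m<n⇒0<n∸m (subst (_< e) (kₘ-∷ʳ _ ys _) lt))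

  inverseˡ : ∀ {μ} → T₀[△₀] μ → T₀ (T₀⁻¹ μ) ≡ μ
  inverseˡ {(b , e) ∷ xs} ((ip , 2≤m) , lt) with initLast xs
  inverseˡ {(b , e) ∷ _} ((ip , s≤s ()) , lt) | []
  ... | ys ∷ʳ′ (l , k) rewrite T₀⁻¹-∷ʳ b e ys l k =
    cong₂ (λ e′ l′ → (b , e′) ∷ ys ∷ʳ (l′ , k))
          (m+[n∸m]≡n (<⇒≤ (subst (_< e) (kₘ-∷ʳ _ ys _) lt))) (m+n∸n≡m l b)

  inverseʳ : ∀ {ν} → △₀ ν → T₀⁻¹ (T₀ ν) ≡ ν
  inverseʳ {[]}                      (((_ , ()) , _))
  inverseʳ {_ ∷ []}                  (((_ , s≤s ()) , _))
  inverseʳ {(a , c) ∷ (b , d) ∷ r} ((ip , _) , _) rewrite T₀⁻¹-∷ʳ b (c + d) r (a ∸ b) c =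
    cong₂ (λ a′ d′ → (a′ , c) ∷ (b , d′) ∷ r) (m∸n+n≡m (<⇒≤ (λ₂<λ₁ _ ip (s≤s (s≤s z≤n))))) (m+n∸m≡n c d)

T₁-inverseOn : InverseOn △₁ T₁[△₁] T₁ T₁⁻¹
T₁-inverseOn = record { maps = maps ; maps⁻¹ = maps⁻¹ ; inverseˡ = inverseˡ ; inverseʳ = inverseʳ }
  where
  maps : ∀ {ν} → △₁ ν → T₁[△₁] (T₁ ν)
  maps {(a , c) ∷ xs} ((ip , 2≤m) , gt) with initLast xs
  maps {(a , c) ∷ _} ((ip , s≤s ()) , gt) | []
  ... | ys ∷ʳ′ (l , k) rewrite T₁-∷ʳ a c ys l k =
    (isPartition-retag ip (m+n≤o⇒m≤o∸n (suc (λ₂ ν)) λ₂+l<a) 0<c+k , 2≤dim-∷ʳ (a ∸ l , c) ys (l , c + k))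
    , subst (c <_) (sym (kₘ-∷ʳ _ ys _)) (m<m+n c (proj₂ (lastPositive ip)))
    where
    ν : Rep
    ν = (a , c) ∷ ys ∷ʳ (l , k)
    λ₂+l<a : λ₂ ν + l < a
    λ₂+l<a = subst (λ x → λ₂ ν + x < a) (λₘ-∷ʳ (a , c) ys (l , k)) gt
    0<c+k : 0 < c + k
    0<c+k = <-≤-trans (proj₂ (lastPositive ip)) (m≤n+m k c)

  maps⁻¹ : ∀ {μ} → T₁[△₁] μ → △₁ (T₁⁻¹ μ)
  maps⁻¹ {(a , c) ∷ xs} ((ip , 2≤m) , lt) with initLast xs
  maps⁻¹ {(a , c) ∷ _} ((ip , s≤s ()) , lt) | []
  ... | ys ∷ʳ′ (l , k) rewrite T₁⁻¹-∷ʳ a c ys l k =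
    ( isPartition-retag ip (<-≤-trans λ₂<a (m≤m+n a l)) (m<n⇒0<n∸m (subst (c <_) (kₘ-∷ʳ _ ys _) lt))
    , 2≤dim-∷ʳ (a + l , c) ys (l , k ∸ c))
    , subst₂ (λ x y → x + y < a + l) (sym (λ₂-∷ʳ _ _ ys l k _)) (sym (λₘ-∷ʳ _ ys _)) (+-monoˡ-< l λ₂<a)
    where
    λ₂<a : λ₂ ((a , c) ∷ ys ∷ʳ (l , k)) < a
    λ₂<a = λ₂<λ₁ _ ip 2≤m

  inverseˡ : ∀ {μ} → T₁[△₁] μ → T₁ (T₁⁻¹ μ) ≡ μ
  inverseˡ {(a , c) ∷ xs} ((ip , 2≤m) , lt) with initLast xs
  inverseˡ {(a , c) ∷ _} ((ip , s≤s ()) , lt) | []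
  ... | ys ∷ʳ′ (l , k) rewrite T₁⁻¹-∷ʳ a c ys l k | T₁-∷ʳ (a + l) c ys l (k ∸ c) =
    cong₂ (λ a′ k′ → (a′ , c) ∷ ys ∷ʳ (l , k′))
          (m+n∸n≡m a l) (m+[n∸m]≡n (<⇒≤ (subst (c <_) (kₘ-∷ʳ _ ys _) lt)))

  inverseʳ : ∀ {ν} → △₁ ν → T₁⁻¹ (T₁ ν) ≡ ν
  inverseʳ {(a , c) ∷ xs} ((ip , 2≤m) , gt) with initLast xs
  inverseʳ {(a , c) ∷ _} ((ip , s≤s ()) , gt) | []
  ... | ys ∷ʳ′ (l , k) rewrite T₁-∷ʳ a c ys l k | T₁⁻¹-∷ʳ (a ∸ l) c ys l (c + k) =
    cong₂ (λ a′ k′ → (a′ , c) ∷ ys ∷ʳ (l , k′)) (m∸n+n≡m l≤a) (m+n∸m≡n c k)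
    where
    λ₂ν : ℕ
    λ₂ν = λ₂ ((a , c) ∷ ys ∷ʳ (l , k))
    l≤a : l ≤ a
    l≤a = ≤-trans (m≤n+m l λ₂ν) (<⇒≤ (subst (λ x → λ₂ν + x < a) (λₘ-∷ʳ (a , c) ys (l , k)) gt))

kₘ-T₀⁻¹ : ∀ x p q qs → kₘ (T₀⁻¹ (x ∷ p ∷ q ∷ qs)) ≡ kₘ₋₁ (x ∷ p ∷ q ∷ qs)
kₘ-T₀⁻¹ x p q qs = cong proj₂ (lastFrom-initFrom p q qs)

kₘ-T₁⁻¹ : ∀ x p ps → kₘ (T₁⁻¹ (x ∷ p ∷ ps)) ≡ kₘ (x ∷ p ∷ ps) ∸ k₁ (x ∷ p ∷ ps)
kₘ-T₁⁻¹ x p ps = kₘ-∷ʳ _ (initFrom p ps) _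

open InverseOn using (maps⁻¹)
open Equivalence using (to; from)

T₀T₀[△₀₀] T₁T₀[△₀₁] T₀T₁[△₁₀] T₁T₁[△₁₁] : Rep → Set
T₀T₀[△₀₀] μ = (P≥ 3 μ × kₘ₋₁ μ < kₘ μ × kₘ μ < k₁ μ) ⊎ (P₂ μ × k₂ μ < k₁ μ × k₁ μ < 2 * k₂ μ)
T₁T₀[△₀₁] μ = P≥ 2 μ × k₁ μ < kₘ μ × kₘ μ < 2 * k₁ μ
T₀T₁[△₁₀] μ = (P≥ 3 μ × kₘ μ < kₘ₋₁ μ × kₘ μ < k₁ μ) ⊎ (P₂ μ × k₁ μ > 2 * k₂ μ)
T₁T₁[△₁₁] μ = P≥ 2 μ × 2 * k₁ μ < kₘ μ

T₀T₀[△₀₀]-via-T₀⁻¹ : ∀ μ → (T₀[△₀] μ × T₀[△₀] (T₀⁻¹ μ)) ⇔ T₀T₀[△₀₀] μ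
T₀T₀[△₀₀]-via-T₀⁻¹ μ = mk⇔ (⇒ μ) (⇐ μ)
  where
  ⇒ : ∀ ν → T₀[△₀] ν × T₀[△₀] (T₀⁻¹ ν) → T₀T₀[△₀₀] ν
  ⇒ []                ((((_ , ()) , _) , _))
  ⇒ (_ ∷ [])          ((((_ , s≤s ()) , _) , _))
  ⇒ (x ∷ p ∷ [])      (((ip , _) , k₂<k₁) , (_ , lt)) =
    inj₂ ((ip , refl) , k₂<k₁ , to (n∸m<m⇔n<2*m (<⇒≤ k₂<k₁)) lt)
  ⇒ (x ∷ p ∷ q ∷ qs) (((ip , _) , kₘ<k₁) , (_ , lt)) =
    inj₁ ((ip , s≤s (s≤s (s≤s z≤n))) , subst (_< _) (kₘ-T₀⁻¹ x p q qs) lt , kₘ<k₁)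

  ⇐ : ∀ ν → T₀T₀[△₀₀] ν → T₀[△₀] ν × T₀[△₀] (T₀⁻¹ ν)
  ⇐ []                (inj₁ ((_ , ()) , _))
  ⇐ []                (inj₂ ((_ , ()) , _))
  ⇐ (_ ∷ [])          (inj₁ ((_ , s≤s ()) , _))
  ⇐ (_ ∷ [])          (inj₂ ((_ , ()) , _))
  ⇐ (x ∷ p ∷ [])      (inj₁ ((_ , s≤s (s≤s ())) , _))
  ⇐ (x ∷ p ∷ [])      (inj₂ ((ip , _) , k₂<k₁ , lt)) =
    h , proj₁ (maps⁻¹ T₀-inverseOn h) , from (n∸m<m⇔n<2*m (<⇒≤ k₂<k₁)) lt
    where
    h : T₀[△₀] (x ∷ p ∷ [])
    h = (ip , s≤s (s≤s z≤n)) , k₂<k₁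
  ⇐ (x ∷ p ∷ q ∷ qs) (inj₁ ((ip , _) , lt , kₘ<k₁)) =
    h , proj₁ (maps⁻¹ T₀-inverseOn h) , subst (_< _) (sym (kₘ-T₀⁻¹ x p q qs)) lt
    where
    h : T₀[△₀] (x ∷ p ∷ q ∷ qs)
    h = (ip , s≤s (s≤s z≤n)) , kₘ<k₁
  ⇐ (x ∷ p ∷ q ∷ qs) (inj₂ ((_ , ()) , _))

T₁T₀[△₀₁]-via-T₁⁻¹ : ∀ μ → (T₁[△₁] μ × T₀[△₀] (T₁⁻¹ μ)) ⇔ T₁T₀[△₀₁] μ
T₁T₀[△₀₁]-via-T₁⁻¹ μ = mk⇔ (⇒ μ) (⇐ μ)
  where
  ⇒ : ∀ ν → T₁[△₁] ν × T₀[△₀] (T₁⁻¹ ν) → T₁T₀[△₀₁] ν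
  ⇒ []           ((((_ , ()) , _) , _))
  ⇒ (_ ∷ [])     ((((_ , s≤s ()) , _) , _))
  ⇒ (x ∷ p ∷ ps) ((dim , k₁<kₘ) , (_ , lt)) =
    dim , k₁<kₘ , to (n∸m<m⇔n<2*m (<⇒≤ k₁<kₘ)) (subst (_< _) (kₘ-T₁⁻¹ x p ps) lt)

  ⇐ : ∀ ν → T₁T₀[△₀₁] ν → T₁[△₁] ν × T₀[△₀] (T₁⁻¹ ν)
  ⇐ []           ((_ , ()) , _)
  ⇐ (_ ∷ [])     ((_ , s≤s ()) , _)
  ⇐ (x ∷ p ∷ ps) (dim , k₁<kₘ , lt) =
    h , proj₁ (maps⁻¹ T₁-inverseOn h)
      , subst (_< _) (sym (kₘ-T₁⁻¹ x p ps)) (from (n∸m<m⇔n<2*m (<⇒≤ k₁<kₘ)) lt)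
    where
    h : T₁[△₁] (x ∷ p ∷ ps)
    h = dim , k₁<kₘ

T₀T₁[△₁₀]-via-T₀⁻¹ : ∀ μ → (T₀[△₀] μ × T₁[△₁] (T₀⁻¹ μ)) ⇔ T₀T₁[△₁₀] μ
T₀T₁[△₁₀]-via-T₀⁻¹ μ = mk⇔ (⇒ μ) (⇐ μ)
  where
  ⇒ : ∀ ν → T₀[△₀] ν × T₁[△₁] (T₀⁻¹ ν) → T₀T₁[△₁₀] ν
  ⇒ []                ((((_ , ()) , _) , _))
  ⇒ (_ ∷ [])          ((((_ , s≤s ()) , _) , _))
  ⇒ (x ∷ p ∷ [])      (((ip , _) , k₂<k₁) , (_ , lt)) =
    inj₂ ((ip , refl) , to (m<n∸m⇔2*m<n (<⇒≤ k₂<k₁)) lt)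
  ⇒ (x ∷ p ∷ q ∷ qs) (((ip , _) , kₘ<k₁) , (_ , lt)) =
    inj₁ ((ip , s≤s (s≤s (s≤s z≤n))) , subst (_ <_) (kₘ-T₀⁻¹ x p q qs) lt , kₘ<k₁)

  ⇐ : ∀ ν → T₀T₁[△₁₀] ν → T₀[△₀] ν × T₁[△₁] (T₀⁻¹ ν)
  ⇐ []                (inj₁ ((_ , ()) , _))
  ⇐ []                (inj₂ ((_ , ()) , _))
  ⇐ (_ ∷ [])          (inj₁ ((_ , s≤s ()) , _))
  ⇐ (_ ∷ [])          (inj₂ ((_ , ()) , _))
  ⇐ (x ∷ p ∷ [])      (inj₁ ((_ , s≤s (s≤s ())) , _))
  ⇐ (x ∷ p ∷ [])      (inj₂ ((ip , _) , lt)) =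
    h , proj₁ (maps⁻¹ T₀-inverseOn h) , from (m<n∸m⇔2*m<n (<⇒≤ k₂<k₁)) lt
    where
    k₂<k₁ : k₂ (x ∷ p ∷ []) < k₁ (x ∷ p ∷ [])
    k₂<k₁ = 2*m<n⇒m<n lt
    h : T₀[△₀] (x ∷ p ∷ [])
    h = (ip , s≤s (s≤s z≤n)) , k₂<k₁
  ⇐ (x ∷ p ∷ q ∷ qs) (inj₁ ((ip , _) , lt , kₘ<k₁)) =
    h , proj₁ (maps⁻¹ T₀-inverseOn h) , subst (_ <_) (sym (kₘ-T₀⁻¹ x p q qs)) lt
    where
    h : T₀[△₀] (x ∷ p ∷ q ∷ qs)
    h = (ip , s≤s (s≤s z≤n)) , kₘ<k₁
  ⇐ (x ∷ p ∷ q ∷ qs) (inj₂ ((_ , ()) , _))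

T₁T₁[△₁₁]-via-T₁⁻¹ : ∀ μ → (T₁[△₁] μ × T₁[△₁] (T₁⁻¹ μ)) ⇔ T₁T₁[△₁₁] μ
T₁T₁[△₁₁]-via-T₁⁻¹ μ = mk⇔ (⇒ μ) (⇐ μ)
  where
  ⇒ : ∀ ν → T₁[△₁] ν × T₁[△₁] (T₁⁻¹ ν) → T₁T₁[△₁₁] ν
  ⇒ []           ((((_ , ()) , _) , _))
  ⇒ (_ ∷ [])     ((((_ , s≤s ()) , _) , _))
  ⇒ (x ∷ p ∷ ps) ((dim , k₁<kₘ) , (_ , lt)) =
    dim , to (m<n∸m⇔2*m<n (<⇒≤ k₁<kₘ)) (subst (_ <_) (kₘ-T₁⁻¹ x p ps) lt)

  ⇐ : ∀ ν → T₁T₁[△₁₁] ν → T₁[△₁] ν × T₁[△₁] (T₁⁻¹ ν)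
  ⇐ []           ((_ , ()) , _)
  ⇐ (_ ∷ [])     ((_ , s≤s ()) , _)
  ⇐ (x ∷ p ∷ ps) (dim , lt) =
    h , proj₁ (maps⁻¹ T₁-inverseOn h)
      , subst (_ <_) (sym (kₘ-T₁⁻¹ x p ps)) (from (m<n∸m⇔2*m<n (<⇒≤ k₁<kₘ)) lt)
    where
    k₁<kₘ : k₁ (x ∷ p ∷ ps) < kₘ (x ∷ p ∷ ps)
    k₁<kₘ = 2*m<n⇒m<n lt
    h : T₁[△₁] (x ∷ p ∷ ps)
    h = dim , k₁<kₘ

mainTheorem8 : (∀ (μ : Rep) → (∃[ l ] (△₀₀ l × T₀ (T₀ l) ≡ μ))
    ⇔ ((P≥ 3 μ × kₘ₋₁ μ < kₘ μ × kₘ μ < k₁ μ) ⊎ (P₂ μ × k₂ μ < k₁ μ × k₁ μ < 2 * k₂ μ)))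
    × (∀ (μ : Rep) → (∃[ l ] (△₀₁ l × T₁ (T₀ l) ≡ μ))
    ⇔ (P≥ 2 μ × k₁ μ < kₘ μ × kₘ μ < 2 * k₁ μ))
    × (∀ (μ : Rep) → (∃[ l ] (△₁₀ l × T₀ (T₁ l) ≡ μ))
    ⇔ ((P≥ 3 μ × kₘ μ < kₘ₋₁ μ × kₘ μ < k₁ μ) ⊎ (P₂ μ × k₁ μ > 2 * k₂ μ)))
    × (∀ (μ : Rep) → (∃[ l ] (△₁₁ l × T₁ (T₁ l) ≡ μ))
    ⇔ (P≥ 2 μ × 2 * k₁ μ < kₘ μ))
mainTheorem8 =
    (λ μ → T₀T₀[△₀₀]-via-T₀⁻¹ μ ⇔-∘ image-∘ T₀-inverseOn T₀-inverseOn μ)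
  , (λ μ → T₁T₀[△₀₁]-via-T₁⁻¹ μ ⇔-∘ image-∘ T₀-inverseOn T₁-inverseOn μ)
  , (λ μ → T₀T₁[△₁₀]-via-T₀⁻¹ μ ⇔-∘ image-∘ T₁-inverseOn T₀-inverseOn μ)
  , (λ μ → T₁T₁[△₁₁]-via-T₁⁻¹ μ ⇔-∘ image-∘ T₁-inverseOn T₁-inverseOn μ)
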